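{- There exists a tangled closure algebra $(A_0,\mathbf{C}^t)$, with induced closure operator $\mathbf{C}$ and interior operator $\mathbf{I}$, together with elements $p_n$ ($n<\omega$) and $q$ of $A_0$ and an ultrafilter $x_0$ of the Boolean algebra $A_0$, such that $\mathbf{C}^t\{q,-q\}\notin x_0$ and $\Sigma\subseteq x_0$, where $$\Sigma=\{p_0\}\cup\{\mathbf{I}(p_{2n}\Rightarrow\mathbf{C}(p_{2n+1}\land q)),\ \mathbf{I}(p_{2n+1}\Rightarrow\mathbf{C}(p_{2n+2}\land -q)):\ n<\omega\}.$$
   Context: A Boolean algebra $A$ has operations $\land,\lor,-,0,1$; $a\Rightarrow b=-a\lor b$. A closure operator on $A$ is $\mathbf{C}:A\to A$ with $\mathbf{C}(a\lor b)=\mathbf{C}a\lor\mathbf{C}b$, $\mathbf{C}0=0$, $a\leq\mathbf{C}a=\mathbf{C}\mathbf{C}a$; interior $\mathbf{I}a=-\mathbf{C}-a$. For $\mathbf{C}^t$ from finite non-empty subsets of $A$ to $A$, the induced $\mathbf{C}a=\mathbf{C}^t\{a\}$, $\mathbf{I}a=-\mathbf{C}^t\{ -a\}$; $(A,\mathbf{C}^t)$ is a tangled closure algebra if $\mathbf{C}$ is a closure operator and for all finite non-empty $\varGamma\subseteq A$ and $a\in A$: (Fix) $\mathbf{C}^t\varGamma\leq\bigwedge_{\gamma\in\varGamma}\mathbf{C}(\gamma\land\mathbf{C}^t\varGamma)$; (Ind) $\mathbf{I}(a\Rightarrow\bigwedge_{\gamma\in\varGamma}\mathbf{C}(\gamma\land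 a))\land a\leq\mathbf{C}^t\varGamma$. -}

module Defs where

open import Level using (Level; _⊔_) renaming (suc to lsuc)
open import Data.Nat using (ℕ; zero; suc; _+_; _*_)
open import Data.Product using (Σ; _×_; _,_)
open import Data.Sum using (_⊎_)
open import Data.List using (List; []; _∷_)
open import Data.List.NonEmpty using (List⁺; _∷_; toList; foldr₁; map)
open import Data.List.Relation.Unary.Any using (Any)
open import Relation.Nullary using () renaming (¬_ to Not)
open import Algebra.Lattice.Bundles using (BooleanAlgebra)

module _ {c ℓ : Level} (B : BooleanAlgebra c ℓ) where
  open BooleanAlgebra B

  _≤_ : Carrier → Carrier → Set ℓ
  a ≤ b = (a ∧ b) ≈ a

  _⇒_ : Carrier → Carrier → Carrier
  a ⇒ b = (¬ a) ∨ b

  -- finite non-empty subsets of A are represented by non-empty lists;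
  -- membership is taken up to the algebra's equality ≈
  _∈≈_ : Carrier → List⁺ Carrier → Set (c ⊔ ℓ)
  a ∈≈ Γ = Any (a ≈_) (toList Γ)

  SameSet : List⁺ Carrier → List⁺ Carrier → Set (c ⊔ ℓ)
  SameSet Γ Δ = (∀ a → a ∈≈ Γ → a ∈≈ Δ) × (∀ a → a ∈≈ Δ → a ∈≈ Γ)

  ⋀ : List⁺ Carrier → Carrier
  ⋀ = foldr₁ _∧_

  record IsClosureOperator (C : Carrier → Carrier) : Set (c ⊔ ℓ) where
    field
      C-∨    : ∀ a b → C (a ∨ b) ≈ (C a ∨ C b)
      C-⊥    : C ⊥ ≈ ⊥
      C-infl : ∀ a → a ≤ C a
      C-idem : ∀ a → C a ≈ C (C a)

  record IsTangledClosure (Ct : List⁺ Carrier → Carrier) : Set (c ⊔ ℓ) where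
    C : Carrier → Carrier
    C a = Ct (a ∷ [])
    I : Carrier → Carrier
    I a = ¬ (Ct ((¬ a) ∷ []))
    field
      -- Ct is a function on finite non-empty subsets (of the quotient by ≈)
      Ct-set  : ∀ Γ Δ → SameSet Γ Δ → Ct Γ ≈ Ct Δ
      closure : IsClosureOperator C
      Fix     : ∀ Γ → Ct Γ ≤ ⋀ (map (λ γ → C (γ ∧ Ct Γ)) Γ)
      Ind     : ∀ Γ a → (I (a ⇒ ⋀ (map (λ γ → C (γ ∧ a)) Γ)) ∧ a) ≤ Ct Γ

  record IsUltrafilter (U : Carrier → Set ℓ) : Set (c ⊔ ℓ) where
    field
      U-resp : ∀ {a b} → a ≈ b → U a → U b
      U-up   : ∀ {a b} → a ≤ b → U a → U b
      U-∧    : ∀ {a b} → U a → U b → U (a ∧ b)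
      U-⊤    : U ⊤
      U-⊥    : Not (U ⊥)
      U-ult  : ∀ a → U a ⊎ U (¬ a)

record TangledClosureAlgebra (c ℓ : Level) : Set (lsuc (c ⊔ ℓ)) where
  field
    BA      : BooleanAlgebra c ℓ
  open BooleanAlgebra BA public
  field
    Ct      : List⁺ Carrier → Carrier
    isTCA   : IsTangledClosure BA Ct
  open IsTangledClosure isTCA public using (C; I)

Witness : ∀ {c ℓ} → TangledClosureAlgebra c ℓ → Set (c ⊔ lsuc ℓ)
Witness {c} {ℓ} T =
  Σ (ℕ → Carrier) λ p → Σ Carrier λ q → Σ (Carrier → Set ℓ) λ x₀ →
    IsUltrafilter BA x₀ ×
    Not (x₀ (Ct (q ∷ ((¬ q) ∷ []))))  ×
    x₀ (p 0) ×
    (∀ n → x₀ (I (_⇒_ BA (p (2 * n)) (C (p (suc (2 * n)) ∧ q))))) ×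
    (∀ n → x₀ (I (_⇒_ BA (p (suc (2 * n))) (C (p (suc (suc (2 * n))) ∧ (¬ q))))))
  where open TangledClosureAlgebra T

-- The algebra A₀ is a subalgebra of the product, over k ∈ ℕ, of the closure
-- algebras of the finite chains 0 < 1 < … < 2k, where a point sees every point
-- below it.  On such a chain every cluster is a single point, so the tangled
-- closure is Ct Γ = ◇(⋀Γ) ("some point below satisfies all of Γ"), and the
-- axioms Fix and Ind hold because the chain is well founded (Ind looks at the
-- least point satisfying a).  Hence any family of subsets closed under the
-- Boolean operations and ◇ is a tangled closure algebra (TangledFamilies).
--
-- We take the *stable* families: from some frame on, frame k+1 arises from frame
-- k by inserting a copy of the two middle points.  They are closed under the
-- operations and ◇, and their value at the apex 2k is eventually constant; this
-- limit is a Boolean homomorphism onto Bool, hence yields an ultrafilter x₀.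
-- With p n = "the point 2k − n" and q = "odd points", each element of Σ holds
-- at the apex of every large frame, while Ct{q,-q} = ◇(q ∧ -q) is empty.

module Submission where

open import Defs hiding (_≤_)
open import Level using (0ℓ)
open import Function using (id; _∘_)
open import Function.Bundles using (Equivalence)
open import Data.Empty using (⊥-elim)
open import Data.Unit using (tt)
open import Data.Product using (Σ; ∃-syntax; _×_; _,_; proj₁; proj₂)
open import Data.Sum using (_⊎_; inj₁; inj₂; [_,_])
open import Data.Bool using (Bool; true; false; not; _∧_; _∨_; T; T?)
open import Data.Bool.Properties using (T-∧; T-∨; ∨-∧-isBooleanAlgebra)
open import Data.Nat
  using (ℕ; zero; suc; _+_; _*_; _⊔_; _≤_; _<_; _≤′_; ≤′-refl; ≤′-step; z≤n; s≤s; _≡ᵇ_; parity)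
open import Data.Nat.Properties
  using (≤-refl; ≤-trans; ≤-pred; <⇒≤; <⇒≢; ≤′⇒≤; <-≤-trans; ≤⇒≤′; m≤n⇒m≤1+n; n≤1+n; m≤n⇒m<n∨m≡n;
         m≤m+n; m≤m⊔n; m≤n⊔m; m⊔n≤o⇒m≤o; m⊔n≤o⇒n≤o; +-suc; +-mono-≤; +-mono-≤-<; +-monoʳ-<;
         *-comm; ≡ᵇ⇒≡)
open import Data.Parity.Base using (Parity; 0ℙ; 1ℙ) renaming (_+_ to _+ₚ_)
open import Data.Parity.Properties using (+-homo-+; p+p≡0ℙ)
open import Data.List using (List; []; _∷_)
open import Data.List.NonEmpty using (List⁺; _∷_; toList) renaming (map to map⁺)
open import Data.List.Relation.Unary.All as All using (All; []; _∷_)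
import Data.List.Relation.Unary.All.Properties as All
import Data.List.Relation.Unary.Any as Any
open import Relation.Nullary using (¬_; yes; no)
open import Relation.Binary.PropositionalEquality
  using (_≡_; refl; sym; trans; cong; cong₂; subst; module ≡-Reasoning)
open ≡-Reasoning
open import Algebra.Lattice.Bundles using (BooleanAlgebra)
open import Algebra.Lattice.Structures using (IsBooleanAlgebra)

open Equivalence using (to; from)

T-ext : ∀ {x y} → (T x → T y) → (T y → T x) → x ≡ y
T-ext {false} {false} _ _ = refl
T-ext {false} {true}  _ g = ⊥-elim (g tt)
T-ext {true}  {false} f _ = ⊥-elim (f tt)
T-ext {true}  {true}  _ _ = refl

not-intro : ∀ {x} → ¬ T x → T (not x)
not-intro {false} _ = tt
not-intro {true}  h = h tt

not-elim : ∀ {x} → T (not x) → ¬ T x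
not-elim {false} _ ()

not-not : ∀ {x} → ¬ T (not x) → T x
not-not {false} h = h tt
not-not {true}  _ = tt

∨-introˡ : ∀ {x y} → T x → T (x ∨ y)
∨-introˡ {x} {y} h = from (T-∨ {x} {y}) (inj₁ h)

∨-introʳ : ∀ {x y} → T y → T (x ∨ y)
∨-introʳ {x} {y} h = from (T-∨ {x} {y}) (inj₂ h)

∧-intro : ∀ {x y} → T x → T y → T (x ∧ y)
∧-intro {x} {y} hx hy = from (T-∧ {x} {y}) (hx , hy)

∨-absorb : ∀ x y → (T y → T x) → x ∨ y ≡ x
∨-absorb x y y⇒x = T-ext (λ h → [ id , y⇒x ] (to (T-∨ {x} {y}) h)) ∨-introˡ

implication-elim : ∀ {x y} → T (not x ∨ y) → T x → T y
implication-elim {x} {y} h hx = [ (λ h¬x → ⊥-elim (not-elim h¬x hx)) , id ] (to (T-∨ {not x} {y}) h)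

◇ : (ℕ → Bool) → ℕ → Bool
◇ p zero    = p zero
◇ p (suc i) = ◇ p i ∨ p (suc i)

□ : (ℕ → Bool) → ℕ → Bool
□ p i = not (◇ (λ j → not (p j)) i)

◇-here : ∀ p i → T (p i) → T (◇ p i)
◇-here p zero    h = h
◇-here p (suc i) h = ∨-introʳ {◇ p i} h

◇-intro : ∀ p {i j} → j ≤ i → T (p j) → T (◇ p i)
◇-intro p {j = j} j≤i pj = go (≤⇒≤′ j≤i)
  where
  go : ∀ {i} → j ≤′ i → T (◇ p i)
  go ≤′-refl          = ◇-here p j pj
  go (≤′-step j≤′i) = ∨-introˡ (go j≤′i)

◇-elim : ∀ p i → T (◇ p i) → ∃[ j ] j ≤ i × T (p j)
◇-elim p zero    h = 0 , z≤n , h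
◇-elim p (suc i) h = [ below , (λ here → suc i , ≤-refl , here) ] (to (T-∨ {◇ p i}) h)
  where
  below : T (◇ p i) → ∃[ j ] j ≤ suc i × T (p j)
  below h′ = let (j , j≤i , pj) = ◇-elim p i h′ in j , m≤n⇒m≤1+n j≤i , pj

◇-never : ∀ p i → (∀ j → ¬ T (p j)) → ¬ T (◇ p i)
◇-never p i never h = let (j , _ , pj) = ◇-elim p i h in never j pj

◇-cong : ∀ p q i → (∀ j → j ≤ i → p j ≡ q j) → ◇ p i ≡ ◇ q i
◇-cong p q zero    eq = eq 0 z≤n
◇-cong p q (suc i) eq =
  cong₂ _∨_ (◇-cong p q i (λ j j≤i → eq j (m≤n⇒m≤1+n j≤i))) (eq (suc i) ≤-refl)

◇-∨ : ∀ p q i → ◇ (λ j → p j ∨ q j) i ≡ ◇ p i ∨ ◇ q i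
◇-∨ p q i = T-ext split join
  where
  split : T (◇ (λ j → p j ∨ q j) i) → T (◇ p i ∨ ◇ q i)
  split h = let (j , j≤i , pqj) = ◇-elim _ i h in
    [ (λ pj → ∨-introˡ (◇-intro p j≤i pj)) , (λ qj → ∨-introʳ {◇ p i} (◇-intro q j≤i qj)) ]
      (to (T-∨ {p j}) pqj)
  join : T (◇ p i ∨ ◇ q i) → T (◇ (λ j → p j ∨ q j) i)
  join h = [ (λ hp → let (j , j≤i , pj) = ◇-elim p i hp in ◇-intro _ j≤i (∨-introˡ pj))
           , (λ hq → let (j , j≤i , qj) = ◇-elim q i hq in ◇-intro _ j≤i (∨-introʳ {p j} qj)) ]
           (to (T-∨ {◇ p i}) h)

◇-idem : ∀ p i → ◇ (◇ p) i ≡ ◇ p i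
◇-idem p i = T-ext twice (◇-here (◇ p) i)
  where
  twice : T (◇ (◇ p) i) → T (◇ p i)
  twice h = let (j , j≤i , h′) = ◇-elim (◇ p) i h
                (j′ , j′≤j , pj′) = ◇-elim p j h′
            in ◇-intro p (≤-trans j′≤j j≤i) pj′

◇-false : ∀ i → ◇ (λ _ → false) i ≡ false
◇-false i = T-ext (◇-never _ i (λ _ ())) (λ ())

□-intro : ∀ p i → (∀ j → j ≤ i → T (p j)) → T (□ p i)
□-intro p i all = not-intro (λ h → let (j , j≤i , ¬pj) = ◇-elim _ i h in not-elim ¬pj (all j j≤i))

□-elim : ∀ p {i j} → T (□ p i) → j ≤ i → T (p j)
□-elim p h j≤i = not-not (λ ¬pj → not-elim h (◇-intro _ j≤i ¬pj))

least-witness : ∀ p i → T (◇ p i) → ∃[ m ] m ≤ i × T (p m) × (∀ {j} → j < m → ¬ T (p j))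
least-witness p zero    h = 0 , z≤n , h , λ ()
least-witness p (suc i) h with T? (◇ p i)
... | yes below = let (m , m≤i , pm , least) = least-witness p i below in
                  m , m≤n⇒m≤1+n m≤i , pm , least
... | no none   = suc i , ≤-refl , [ (λ b → ⊥-elim (none b)) , id ] (to (T-∨ {◇ p i}) h)
                , λ j<1+i pj → none (◇-intro p (≤-pred j<1+i) pj)

-- The induction axiom of tangled closure on ω: if a holds at i and every
-- a-point j ≤ i sees, for each γ ∈ Γ, a (γ ∧ a)-point below it, then some
-- point below i satisfies all of Γ — namely the least a-point.
chain-induction : ∀ {A : Set} (⟪_⟫ : A → ℕ → Bool) (a : ℕ → Bool) (Γ : List A) i → T (a i) →
  (∀ j → j ≤ i → T (a j) → All (λ γ → T (◇ (λ j′ → ⟪ γ ⟫ j′ ∧ a j′) j)) Γ) →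
  ∃[ m ] m ≤ i × All (λ γ → T (⟪ γ ⟫ m)) Γ
chain-induction ⟪_⟫ a Γ i ai sees with least-witness a i (◇-here a i ai)
... | m , m≤i , am , least = m , m≤i , All.map at-least (sees m m≤i am)
  where
  at-least : ∀ {γ} → T (◇ (λ j′ → ⟪ γ ⟫ j′ ∧ a j′) m) → T (⟪ γ ⟫ m)
  at-least {γ} h with ◇-elim _ m h
  ... | j , j≤m , γaj with to (T-∧ {⟪ γ ⟫ j}) γaj | m≤n⇒m<n∨m≡n j≤m
  ...   | _  , aj | inj₁ j<m = ⊥-elim (least j<m aj)
  ...   | γj , _  | inj₂ refl = γj

module PredicateAlgebra {X : Set} (S : (X → Bool) → Set)
  (S-∨ : ∀ {P Q} → S P → S Q → S (λ x → P x ∨ Q x))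
  (S-∧ : ∀ {P Q} → S P → S Q → S (λ x → P x ∧ Q x))
  (S-not : ∀ {P} → S P → S (λ x → not (P x)))
  (S-true : S (λ _ → true))
  (S-false : S (λ _ → false))
  where

  El : Set
  El = Σ (X → Bool) S

  ⟦_⟧ : El → X → Bool
  ⟦_⟧ = proj₁

  _≈ₚ_ : El → El → Set
  a ≈ₚ b = ∀ x → ⟦ a ⟧ x ≡ ⟦ b ⟧ x

  _∨ₚ_ _∧ₚ_ : El → El → El
  a ∨ₚ b = (λ x → ⟦ a ⟧ x ∨ ⟦ b ⟧ x) , S-∨ (proj₂ a) (proj₂ b)
  a ∧ₚ b = (λ x → ⟦ a ⟧ x ∧ ⟦ b ⟧ x) , S-∧ (proj₂ a) (proj₂ b)

  ¬ₚ : El → El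
  ¬ₚ a = (λ x → not (⟦ a ⟧ x)) , S-not (proj₂ a)

  private module 𝔹 = IsBooleanAlgebra ∨-∧-isBooleanAlgebra

  isBooleanAlgebra : IsBooleanAlgebra _≈ₚ_ _∨ₚ_ _∧ₚ_ ¬ₚ ((λ _ → true) , S-true) ((λ _ → false) , S-false)
  isBooleanAlgebra = record
    { isDistributiveLattice = record
      { isLattice = record
        { isEquivalence = record
          { refl = λ _ → refl ; sym = λ p x → sym (p x) ; trans = λ p q x → trans (p x) (q x) }
        ; ∨-comm = λ a b x → 𝔹.∨-comm (⟦ a ⟧ x) (⟦ b ⟧ x)
        ; ∨-assoc = λ a b c x → 𝔹.∨-assoc (⟦ a ⟧ x) (⟦ b ⟧ x) (⟦ c ⟧ x)
        ; ∨-cong = λ p q x → cong₂ _∨_ (p x) (q x)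
        ; ∧-comm = λ a b x → 𝔹.∧-comm (⟦ a ⟧ x) (⟦ b ⟧ x)
        ; ∧-assoc = λ a b c x → 𝔹.∧-assoc (⟦ a ⟧ x) (⟦ b ⟧ x) (⟦ c ⟧ x)
        ; ∧-cong = λ p q x → cong₂ _∧_ (p x) (q x)
        ; absorptive = (λ a b x → proj₁ 𝔹.absorptive (⟦ a ⟧ x) (⟦ b ⟧ x))
                     , (λ a b x → proj₂ 𝔹.absorptive (⟦ a ⟧ x) (⟦ b ⟧ x))
        }
      ; ∨-distrib-∧ = (λ a b c x → proj₁ 𝔹.∨-distrib-∧ (⟦ a ⟧ x) (⟦ b ⟧ x) (⟦ c ⟧ x))
                    , (λ a b c x → proj₂ 𝔹.∨-distrib-∧ (⟦ a ⟧ x) (⟦ b ⟧ x) (⟦ c ⟧ x))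
      ; ∧-distrib-∨ = (λ a b c x → proj₁ 𝔹.∧-distrib-∨ (⟦ a ⟧ x) (⟦ b ⟧ x) (⟦ c ⟧ x))
                    , (λ a b c x → proj₂ 𝔹.∧-distrib-∨ (⟦ a ⟧ x) (⟦ b ⟧ x) (⟦ c ⟧ x))
      }
    ; ∨-complement = (λ a x → proj₁ 𝔹.∨-complement (⟦ a ⟧ x)) , (λ a x → proj₂ 𝔹.∨-complement (⟦ a ⟧ x))
    ; ∧-complement = (λ a x → proj₁ 𝔹.∧-complement (⟦ a ⟧ x)) , (λ a x → proj₂ 𝔹.∧-complement (⟦ a ⟧ x))
    ; ¬-cong = λ p x → cong not (p x)
    }

  algebra : BooleanAlgebra 0ℓ 0ℓ
  algebra = record { isBooleanAlgebra = isBooleanAlgebra }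

  ≤-intro : ∀ a b → (∀ x → T (⟦ a ⟧ x) → T (⟦ b ⟧ x)) → Defs._≤_ algebra a b
  ≤-intro a b a⇒b x = T-ext (λ h → proj₁ (to (T-∧ {⟦ a ⟧ x}) h)) (λ h → ∧-intro h (a⇒b x h))

  ⋀-elim : ∀ Γ {x} → T (⟦ ⋀ algebra Γ ⟧ x) → All (λ γ → T (⟦ γ ⟧ x)) (toList Γ)
  ⋀-elim (γ ∷ γs) = elim γ γs
    where
    elim : ∀ γ γs {x} → T (⟦ ⋀ algebra (γ ∷ γs) ⟧ x) → All (λ γ → T (⟦ γ ⟧ x)) (γ ∷ γs)
    elim γ []       h = h ∷ []
    elim γ (δ ∷ δs) {x} h = let (hγ , hδs) = to (T-∧ {⟦ γ ⟧ x}) h in hγ ∷ elim δ δs hδs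

  ⋀-intro : ∀ Γ {x} → All (λ γ → T (⟦ γ ⟧ x)) (toList Γ) → T (⟦ ⋀ algebra Γ ⟧ x)
  ⋀-intro (γ ∷ γs) = intro γ γs
    where
    intro : ∀ γ γs {x} → All (λ γ → T (⟦ γ ⟧ x)) (γ ∷ γs) → T (⟦ ⋀ algebra (γ ∷ γs) ⟧ x)
    intro γ []       (hγ ∷ [])  = hγ
    intro γ (δ ∷ δs) (hγ ∷ hδs) = ∧-intro hγ (intro δ δs hδs)

  ⋀-respects-SameSet : ∀ Γ Δ → SameSet algebra Γ Δ → ⋀ algebra Γ ≈ₚ ⋀ algebra Δ
  ⋀-respects-SameSet Γ Δ (Γ⊆Δ , Δ⊆Γ) x = T-ext (transfer Γ Δ Δ⊆Γ) (transfer Δ Γ Γ⊆Δ)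
    where
    transfer : ∀ Γ Δ → (∀ a → _∈≈_ algebra a Δ → _∈≈_ algebra a Γ) →
               T (⟦ ⋀ algebra Γ ⟧ x) → T (⟦ ⋀ algebra Δ ⟧ x)
    transfer Γ Δ Δ⊆Γ h = ⋀-intro Δ (All.tabulate λ {δ} δ∈Δ →
      let (hγ , δ≈γ) = All.lookupAny (⋀-elim Γ h) (Δ⊆Γ δ (Any.map (λ { refl _ → refl }) δ∈Δ))
      in subst T (sym (δ≈γ x)) hγ)

lower : ∀ {K : Set} → (K × ℕ → Bool) → K × ℕ → Bool
lower P (k , i) = ◇ (λ j → P (k , j)) i

module TangledFamilies {K : Set} (S : (K × ℕ → Bool) → Set)
  (S-∨ : ∀ {P Q} → S P → S Q → S (λ x → P x ∨ Q x))
  (S-∧ : ∀ {P Q} → S P → S Q → S (λ x → P x ∧ Q x))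
  (S-not : ∀ {P} → S P → S (λ x → not (P x)))
  (S-true : S (λ _ → true))
  (S-false : S (λ _ → false))
  (S-lower : ∀ {P} → S P → S (lower P))
  where

  open PredicateAlgebra S S-∨ S-∧ S-not S-true S-false public

  Ct : List⁺ El → El
  Ct Γ = lower ⟦ ⋀ algebra Γ ⟧ , S-lower (proj₂ (⋀ algebra Γ))

  isClosure : IsClosureOperator algebra (λ a → Ct (a ∷ []))
  isClosure = record
    { C-∨    = λ a b (k , i) → ◇-∨ _ _ i
    ; C-⊥    = λ (k , i) → ◇-false i
    ; C-infl = λ a → ≤-intro a (Ct (a ∷ [])) (λ (k , i) → ◇-here (λ j → ⟦ a ⟧ (k , j)) i)
    ; C-idem = λ a (k , i) → sym (◇-idem _ i)
    }

  isTangledClosure : IsTangledClosure algebra Ct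
  isTangledClosure = record
    { Ct-set  = λ Γ Δ same (k , i) → ◇-cong _ _ i (λ j _ → ⋀-respects-SameSet Γ Δ same (k , j))
    ; closure = isClosure
    ; Fix     = fix
    ; Ind     = ind
    }
    where
    -- A point below i satisfying ⋀Γ witnesses γ ∧ Ct Γ for every γ ∈ Γ.
    fix : ∀ Γ → Defs._≤_ algebra (Ct Γ) (⋀ algebra (map⁺ (λ γ → Ct ((γ ∧ₚ Ct Γ) ∷ [])) Γ))
    fix Γ = ≤-intro (Ct Γ) (⋀ algebra (map⁺ (λ γ → Ct ((γ ∧ₚ Ct Γ) ∷ [])) Γ)) λ (k , i) h →
      let (j , j≤i , ⋀Γj) = ◇-elim _ i h in
      ⋀-intro (map⁺ _ Γ) (All.map⁺ (All.map (λ γj → ◇-intro _ j≤i (∧-intro γj (◇-here _ j ⋀Γj)))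
                                             (⋀-elim Γ ⋀Γj)))

    induction-premise : List⁺ El → El → El
    induction-premise Γ a =
      ¬ₚ (Ct (¬ₚ (¬ₚ a ∨ₚ ⋀ algebra (map⁺ (λ γ → Ct ((γ ∧ₚ a) ∷ [])) Γ)) ∷ [])) ∧ₚ a

    -- At the least a-point below i the premise forces every γ ∈ Γ to hold.
    ind : ∀ Γ a → Defs._≤_ algebra (induction-premise Γ a) (Ct Γ)
    ind Γ a = ≤-intro (induction-premise Γ a) (Ct Γ)
      λ (k , i) h →
      let (interior , ai) = to (T-∧ {□ _ i}) h
          sees j j≤i aj = All.map⁻ (⋀-elim (map⁺ _ Γ) (implication-elim (□-elim _ interior j≤i) aj))
          (m , m≤i , Γm) = chain-induction (λ γ j → ⟦ γ ⟧ (k , j)) (λ j → ⟦ a ⟧ (k , j))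
                                           (toList Γ) i ai sees
      in ◇-intro _ m≤i (⋀-intro Γ Γm)

module _ {c} (B : BooleanAlgebra c 0ℓ) where
  private module B = BooleanAlgebra B

  homomorphism-ultrafilter : (h : B.Carrier → Bool) →
    (∀ {a b} → a B.≈ b → h a ≡ h b) → (∀ a b → h (a B.∧ b) ≡ h a ∧ h b) →
    (∀ a → h (B.¬ a) ≡ not (h a)) → h B.⊤ ≡ true → h B.⊥ ≡ false →
    IsUltrafilter B (λ a → T (h a))
  homomorphism-ultrafilter h h-cong h-∧ h-¬ h-⊤ h-⊥ = record
    { U-resp = λ a≈b → subst T (h-cong a≈b)
    ; U-up   = λ {a} {b} a≤b ha →
        proj₂ (to (T-∧ {h a}) (subst T (trans (sym (h-cong a≤b)) (h-∧ a b)) ha))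
    ; U-∧    = λ {a} {b} ha hb → subst T (sym (h-∧ a b)) (∧-intro ha hb)
    ; U-⊤    = subst T (sym h-⊤) tt
    ; U-⊥    = λ h⊥ → subst T h-⊥ h⊥
    ; U-ult  = decide
    }
    where
    decide : ∀ a → T (h a) ⊎ T (h (B.¬ a))
    decide a with h a | h-¬ a
    ... | true  | _      = inj₁ tt
    ... | false | h¬a≡tt = inj₂ (subst T (sym h¬a≡tt) tt)

-- Stable families of predicates on the frames 0 < … < 2k: from frame `from` on,
-- frame k+1 is frame k with the bottom half kept, the top half shifted up by
-- two, and the new middle point a copy of the point two below it.

record Stable (P : ℕ × ℕ → Bool) : Set where
  field
    from   : ℕ
    bottom : ∀ {k i} → from ≤ k → i ≤ k → P (suc k , i) ≡ P (k , i)
    top    : ∀ {k i} → from ≤ k → k ≤ i → P (suc k , 2 + i) ≡ P (k , i)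
    middle : ∀ {k} → from ≤ k → P (2 + k , 2 + k) ≡ P (suc k , k)

open Stable

stable-constant : ∀ b → Stable (λ _ → b)
stable-constant b = record
  { from = 0 ; bottom = λ _ _ → refl ; top = λ _ _ → refl ; middle = λ _ → refl }

stable-pointwise₁ : ∀ (f : Bool → Bool) {P} → Stable P → Stable (λ x → f (P x))
stable-pointwise₁ f s = record
  { from   = from s
  ; bottom = λ k≥ i≤k → cong f (bottom s k≥ i≤k)
  ; top    = λ k≥ k≤i → cong f (top s k≥ k≤i)
  ; middle = λ k≥ → cong f (middle s k≥)
  }

stable-pointwise₂ : ∀ (_⊕_ : Bool → Bool → Bool) {P Q} → Stable P → Stable Q → Stable (λ x → P x ⊕ Q x)
stable-pointwise₂ _⊕_ s t = record
  { from   = from s ⊔ from t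
  ; bottom = λ k≥ i≤k → cong₂ _⊕_ (bottom s (left k≥) i≤k) (bottom t (right k≥) i≤k)
  ; top    = λ k≥ k≤i → cong₂ _⊕_ (top s (left k≥) k≤i) (top t (right k≥) k≤i)
  ; middle = λ k≥ → cong₂ _⊕_ (middle s (left k≥)) (middle t (right k≥))
  }
  where
  left : ∀ {k} → from s ⊔ from t ≤ k → from s ≤ k
  left = m⊔n≤o⇒m≤o (from s) (from t)
  right : ∀ {k} → from s ⊔ from t ≤ k → from t ≤ k
  right = m⊔n≤o⇒n≤o (from s) (from t)

module _ {P : ℕ × ℕ → Bool} (s : Stable P) where

  -- Points of the bottom half see only bottom-half points, which are unchanged.
  lower-bottom : ∀ {k i} → from s ≤ k → i ≤ k → lower P (suc k , i) ≡ lower P (k , i)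
  lower-bottom k≥ i≤k = ◇-cong _ _ _ (λ j j≤i → bottom s k≥ (≤-trans j≤i i≤k))

  -- The new middle point 2+m of frame 2+m copies the point m, which lies below
  -- the middle, so ◇P at the middle does not change.
  lower-middle : ∀ {m} → from s ≤ m → lower P (2 + m , 2 + m) ≡ lower P (suc m , suc m)
  lower-middle {m} m≥ = begin
    lower P (2 + m , suc m) ∨ P (2 + m , 2 + m)
      ≡⟨ cong₂ _∨_ (lower-bottom (m≤n⇒m≤1+n m≥) ≤-refl) (middle s m≥) ⟩
    lower P (suc m , suc m) ∨ P (suc m , m)
      ≡⟨ ∨-absorb _ _ (◇-intro _ (n≤1+n m)) ⟩
    lower P (suc m , suc m) ∎

  -- Going up the top half, ◇P accumulates the same (shifted) points in both frames.
  lower-top : ∀ {m i} → from s ≤ m → suc m ≤ i → lower P (2 + m , 2 + i) ≡ lower P (suc m , i)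
  lower-top {m} m≥ m<i = go (≤⇒≤′ m<i)
    where
    go : ∀ {i} → suc m ≤′ i → lower P (2 + m , 2 + i) ≡ lower P (suc m , i)
    go ≤′-refl = begin
      lower P (2 + m , 2 + m) ∨ P (2 + m , 3 + m)
        ≡⟨ cong₂ _∨_ (lower-middle m≥) (top s (m≤n⇒m≤1+n m≥) ≤-refl) ⟩
      lower P (suc m , suc m) ∨ P (suc m , suc m)
        ≡⟨ ∨-absorb _ _ (◇-here _ (suc m)) ⟩
      lower P (suc m , suc m) ∎
    go (≤′-step {i} m<′i) =
      cong₂ _∨_ (go m<′i) (top s (m≤n⇒m≤1+n m≥) (m≤n⇒m≤1+n (≤′⇒≤ m<′i)))

  stable-lower : Stable (lower P)
  stable-lower = record
    { from   = suc (from s)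
    ; bottom = λ k> i≤k → lower-bottom (<⇒≤ k>) i≤k
    ; top    = λ { (s≤s m≥) k≤i → lower-top m≥ k≤i }
    ; middle = λ { {suc m} (s≤s m≥) → trans (lower-middle (m≤n⇒m≤1+n m≥)) (new-point-below m≥) }
    }
    where
    -- In frame 2+m the middle point 2+m is a copy of m, below 1+m.
    new-point-below : ∀ {m} → from s ≤ m → lower P (2 + m , 2 + m) ≡ lower P (2 + m , suc m)
    new-point-below {m} m≥ = ∨-absorb _ _ λ h →
      ◇-intro _ (n≤1+n m) (subst T (sym (bottom s (m≤n⇒m≤1+n m≥) (n≤1+n m))) (subst T (middle s m≥) h))

apex : (ℕ × ℕ → Bool) → ℕ → Bool
apex P k = P (k , k + k)

apex-eventually : ∀ {P} (s : Stable P) {k} → from s ≤ k → apex P k ≡ apex P (from s)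
apex-eventually {P} s k≥ = go (≤⇒≤′ k≥)
  where
  go : ∀ {k} → from s ≤′ k → apex P k ≡ apex P (from s)
  go ≤′-refl = refl
  go (≤′-step {k} k≥′) = begin
    P (suc k , suc (k + suc k)) ≡⟨ cong (λ i → P (suc k , suc i)) (+-suc k k) ⟩
    P (suc k , 2 + (k + k))     ≡⟨ top s (≤′⇒≤ k≥′) (m≤m+n k k) ⟩
    P (k , k + k)               ≡⟨ go k≥′ ⟩
    apex P (from s)             ∎

module Stable-families = TangledFamilies Stable (stable-pointwise₂ _∨_) (stable-pointwise₂ _∧_)
  (stable-pointwise₁ not) (stable-constant true) (stable-constant false) stable-lower
open Stable-families using (El; ⟦_⟧; algebra; _∧ₚ_; ¬ₚ; Ct; isTangledClosure)

A₀ : TangledClosureAlgebra 0ℓ 0ℓ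
A₀ = record { BA = algebra ; Ct = Ct ; isTCA = isTangledClosure }

open TangledClosureAlgebra A₀ using (C; I)

limit : El → Bool
limit x = apex ⟦ x ⟧ (from (proj₂ x))

limit-at : ∀ x {k} → from (proj₂ x) ≤ k → apex ⟦ x ⟧ k ≡ limit x
limit-at x = apex-eventually (proj₂ x)

x₀ : El → Set
x₀ x = T (limit x)

x₀-ultrafilter : IsUltrafilter algebra x₀
x₀-ultrafilter =
  homomorphism-ultrafilter algebra limit (λ {a} {b} → limit-cong {a} {b}) limit-∧ (λ _ → refl) refl refl
  where
  limit-cong : ∀ {a b} → (∀ x → ⟦ a ⟧ x ≡ ⟦ b ⟧ x) → limit a ≡ limit b
  limit-cong {a} {b} a≈b =
    trans (sym (limit-at a (m≤m⊔n _ _))) (trans (a≈b _) (limit-at b (m≤n⊔m _ _)))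
  limit-∧ : ∀ a b → limit (a ∧ₚ b) ≡ limit a ∧ limit b
  limit-∧ a b = cong₂ _∧_ (limit-at a (m≤m⊔n _ _)) (limit-at b (m≤n⊔m _ _))

point : ℕ → ℕ × ℕ → Bool
point n (k , i) = i + n ≡ᵇ k + k

≡ᵇ-false : ∀ {m n} → m < n → (m ≡ᵇ n) ≡ false
≡ᵇ-false {m} {n} m<n = T-ext (λ e → ⊥-elim (<⇒≢ m<n (≡ᵇ⇒≡ m n e))) λ ()

-- Once n < k, the point 2k − n lies in the top half and moves with the apex.
stable-point : ∀ n → Stable (point n)
stable-point n = record
  { from   = suc n
  ; bottom = λ {k} {i} n<k i≤k → let below = +-mono-≤-< i≤k n<k in
      trans (≡ᵇ-false (<-≤-trans below (double-mono k))) (sym (≡ᵇ-false below))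
  ; top    = λ {k} {i} _ _ → cong (suc (i + n) ≡ᵇ_) (+-suc k k)
  ; middle = λ {k} n<k →
      trans (≡ᵇ-false (+-monoʳ-< (2 + k) (m≤n⇒m≤1+n (m≤n⇒m≤1+n n<k))))
            (sym (≡ᵇ-false (<-≤-trans (+-monoʳ-< k n<k) (double-mono k))))
  }
  where
  double-mono : ∀ k → k + k ≤ suc k + suc k
  double-mono k = +-mono-≤ (n≤1+n k) (n≤1+n k)

isOne : Parity → Bool
isOne 0ℙ = false
isOne 1ℙ = true

odd : ℕ → Bool
odd i = isOne (parity i)

p : ℕ → El
p n = point n , stable-point n

q : El
q = (λ (k , i) → odd i) , record
  { from = 0 ; bottom = λ _ _ → refl ; top = λ _ _ → refl ; middle = λ _ → refl }

parity-complement : ∀ j m k → j + m ≡ k + k → parity j ≡ parity m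
parity-complement j m k e = cancel (begin
  parity j +ₚ parity m ≡⟨ sym (+-homo-+ j m) ⟩
  parity (j + m)       ≡⟨ cong parity e ⟩
  parity (k + k)       ≡⟨ +-homo-+ k k ⟩
  parity k +ₚ parity k ≡⟨ p+p≡0ℙ (parity k) ⟩
  0ℙ                   ∎)
  where
  cancel : ∀ {π ρ} → π +ₚ ρ ≡ 0ℙ → π ≡ ρ
  cancel {0ℙ} {0ℙ} _ = refl
  cancel {1ℙ} {1ℙ} _ = refl

parity-even : ∀ n → parity (2 * n) ≡ 0ℙ
parity-even n = trans (cong parity (*-comm 2 n)) (go n)
  where
  go : ∀ n → parity (n * 2) ≡ 0ℙ
  go zero    = refl
  go (suc n) = go n

parity-odd : ∀ n → parity (suc (2 * n)) ≡ 1ℙ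
parity-odd n = trans (cong (λ m → parity (suc m)) (*-comm 2 n)) (go n)
  where
  go : ∀ n → parity (suc (n * 2)) ≡ 1ℙ
  go zero    = refl
  go (suc n) = go n

q-at-odd : ∀ n k j → parity j ≡ parity (suc (2 * n)) → T (⟦ q ⟧ (k , j))
q-at-odd n _ _ e = subst (T ∘ isOne) (sym (trans e (parity-odd n))) tt

¬q-at-even : ∀ n k j → parity j ≡ parity (suc (suc (2 * n))) → T (⟦ ¬ₚ q ⟧ (k , j))
¬q-at-even n _ _ e = subst (T ∘ not ∘ isOne) (sym (trans e (parity-even n))) tt

-- Each implication of Σ holds at the apex of every large frame k: the point
-- 2k − m has below it the point 2k − m − 1, which has the parity of m + 1.
Σ-member : ∀ m (r : El) → (∀ k j → parity j ≡ parity (suc m) → T (⟦ r ⟧ (k , j))) →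
  x₀ (I (_⇒_ algebra (p m) (C (p (suc m) ∧ₚ r))))
Σ-member m r r-parity =
  subst T (limit-at x (m≤m⊔n (from (proj₂ x)) (suc m)))
    (□-intro (λ j → ⟦ step ⟧ (k , j)) (k + k) (λ j _ → at j))
  where
  step x : El
  step = _⇒_ algebra (p m) (C (p (suc m) ∧ₚ r))
  x = I step
  k : ℕ
  k = from (proj₂ x) ⊔ suc m
  m<k+k : m < k + k
  m<k+k = ≤-trans (m≤n⊔m (from (proj₂ x)) (suc m)) (m≤m+n k k)
  at : ∀ j → T (not (j + m ≡ᵇ k + k) ∨ ◇ (λ j′ → (j′ + suc m ≡ᵇ k + k) ∧ ⟦ r ⟧ (k , j′)) j)
  at zero = ∨-introˡ (not-intro (λ e → <⇒≢ m<k+k (≡ᵇ⇒≡ m (k + k) e)))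
  at (suc j) with T? (suc j + m ≡ᵇ k + k)
  ... | no ¬e = ∨-introˡ (not-intro ¬e)
  ... | yes e = ∨-introʳ {not (suc j + m ≡ᵇ k + k)}
                  (◇-intro _ (n≤1+n j) (∧-intro e′ (r-parity k j same-parity)))
    where
    e′ : T (j + suc m ≡ᵇ k + k)
    e′ = subst (λ z → T (z ≡ᵇ k + k)) (sym (+-suc j m)) e
    same-parity : parity j ≡ parity (suc m)
    same-parity = parity-complement j (suc m) k (≡ᵇ⇒≡ (j + suc m) (k + k) e′)

Ct-q¬q∉x₀ : ¬ x₀ (Ct (q ∷ (¬ₚ q ∷ [])))
Ct-q¬q∉x₀ = ◇-never (λ j → odd j ∧ not (odd j)) (n + n)
  (λ j h → let (o , ¬o) = to (T-∧ {odd j}) h in not-elim ¬o o)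
  where
  n : ℕ
  n = from (proj₂ (Ct (q ∷ (¬ₚ q ∷ []))))

lemma5p2 : Σ (TangledClosureAlgebra 0ℓ 0ℓ) Witness
lemma5p2 = A₀ , p , q , x₀ , x₀-ultrafilter , Ct-q¬q∉x₀ , tt
  , (λ n → Σ-member (2 * n) q (q-at-odd n))
  , (λ n → Σ-member (suc (2 * n)) (¬ₚ q) (¬q-at-even n))
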